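{- Let $n\ge2$ and $\tau_i=(c_i,d_i,p_i,J_i)$, $i=1,\dots,n$, nonnegative integers with $c_i\ge1$, $p_i\ge1$, $c_i\le d_i\le p_i$, $0\le J_i\le p_i$, $\sum_{i<n}c_i/p_i<1$. Let $I\subseteq\{1,\dots,n-1\}$. For integers $k$ and $\gamma$ let \[ \mathcal{M}(I,k)=\min\Big\{s+\sum_{i\in I}c_ix_i : s+p_ix_i\ge k+J_i\ \forall i\in I,\ s\in\mathbb{Z}_{\ge0},\ x\in\mathbb{Z}^I\Big\},\qquad \mathcal{R}(I,\gamma)=\min\Big\{t\in\mathbb{Z}_{\ge0}: t\ge\gamma+\sum_{i\in I}c_i\Big\lceil\frac{t+J_i}{p_i}\Big\rceil\Big\}. \] Let $\beta$ be an integer with $\beta\ge S$, where $S$ is the largest value of $s$ among optimal solutions $(s,x)$ of $\mathcal{M}(I,\beta)$. Then for every integer $k$: $\mathcal{M}(I,\beta)\le k$ if and only if $\mathcal{R}(I,\beta-k)\le\beta$. -}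

module Defs where

open import Data.Nat as ℕ using (ℕ; zero; suc)
open import Data.Nat.DivMod using (_/_)
open import Data.Integer as ℤ using (ℤ; +_)
open import Data.Rational as ℚ using (ℚ)
open import Data.Fin using (Fin; toℕ)
open import Data.Bool using (Bool; true; false; if_then_else_)
open import Data.Product using (Σ; _×_; _,_)
open import Relation.Binary.PropositionalEquality using (_≡_)

record Tau : Set where
  constructor mkTau
  field
    c d p J : ℕ
open Tau public

ValidTau : Tau → Set
ValidTau τ = 1 ℕ.≤ c τ × 1 ℕ.≤ p τ × c τ ℕ.≤ d τ × d τ ℕ.≤ p τ × J τ ℕ.≤ p τ

sumℤ : (n : ℕ) → (Fin n → ℤ) → ℤ
sumℤ zero f = ℤ.0ℤ
sumℤ (suc n) f = f Fin.zero ℤ.+ sumℤ n (λ i → f (Fin.suc i))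
  where import Data.Fin as Fin

sumℚ : (n : ℕ) → (Fin n → ℚ) → ℚ
sumℚ zero f = ℚ.0ℚ
sumℚ (suc n) f = f Fin.zero ℚ.+ sumℚ n (λ i → f (Fin.suc i))
  where import Data.Fin as Fin

-- frac c p = c / p as a rational (p ≥ 1 is assumed where used; value 0 if p = 0).
frac : ℕ → ℕ → ℚ
frac c' zero = ℚ.0ℚ
frac c' (suc q) = (+ c') ℚ./ suc q

-- Ceiling division ⌈a / p⌉ for natural a and p ≥ 1 (value 0 if p = 0).
cdiv : ℕ → ℕ → ℕ
cdiv a zero = 0
cdiv a (suc q) = (a ℕ.+ q) / suc q

-- Fin n is indexed from 0, so paper index i ∈ {1,…,n} is Fin index i-1;
-- paper condition i < n  ⇔  suc (toℕ j) < n for the Fin index j.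
Front : (n : ℕ) → Fin n → Set
Front n j = suc (toℕ j) ℕ.< n

frontSum : (n : ℕ) → (Fin n → Tau) → ℚ
frontSum n τ = sumℚ n (λ j → if suc (toℕ j) ℕ.<ᵇ n then frac (c (τ j)) (p (τ j)) else ℚ.0ℚ)

SubsetFront : (n : ℕ) → (Fin n → Bool) → Set
SubsetFront n I = (j : Fin n) → I j ≡ true → Front n j

-- Feasibility for M(I,k): s ∈ ℤ≥0, x ∈ ℤ^I (entries outside I are irrelevant),
-- s + p_i x_i ≥ k + J_i for all i ∈ I.
FeasM : (n : ℕ) → (Fin n → Tau) → (Fin n → Bool) → ℤ → ℕ → (Fin n → ℤ) → Set
FeasM n τ I k s x = (j : Fin n) → I j ≡ true →
  k ℤ.+ + J (τ j) ℤ.≤ + s ℤ.+ + p (τ j) ℤ.* x j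

objM : (n : ℕ) → (Fin n → Tau) → (Fin n → Bool) → ℕ → (Fin n → ℤ) → ℤ
objM n τ I s x = + s ℤ.+ sumℤ n (λ j → if I j then + c (τ j) ℤ.* x j else ℤ.0ℤ)

IsLeast : (ℤ → Set) → ℤ → Set
IsLeast P m = P m × ((m' : ℤ) → P m' → m ℤ.≤ m')

IsGreatest : (ℤ → Set) → ℤ → Set
IsGreatest P m = P m × ((m' : ℤ) → P m' → m' ℤ.≤ m)

ValM : (n : ℕ) → (Fin n → Tau) → (Fin n → Bool) → ℤ → ℤ → Set
ValM n τ I k v = Σ ℕ λ s → Σ (Fin n → ℤ) λ x → FeasM n τ I k s x × objM n τ I s x ≡ v

IsM : (n : ℕ) → (Fin n → Tau) → (Fin n → Bool) → ℤ → ℤ → Set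
IsM n τ I k m = IsLeast (ValM n τ I k) m

OptM : (n : ℕ) → (Fin n → Tau) → (Fin n → Bool) → ℤ → ℕ → (Fin n → ℤ) → Set
OptM n τ I k s x = FeasM n τ I k s x ×
  ((s' : ℕ) (x' : Fin n → ℤ) → FeasM n τ I k s' x' → objM n τ I s x ℤ.≤ objM n τ I s' x')

OptS : (n : ℕ) → (Fin n → Tau) → (Fin n → Bool) → ℤ → ℤ → Set
OptS n τ I k v = Σ ℕ λ s → Σ (Fin n → ℤ) λ x → OptM n τ I k s x × + s ≡ v

FeasR : (n : ℕ) → (Fin n → Tau) → (Fin n → Bool) → ℤ → ℤ → Set
FeasR n τ I γ t = Σ ℕ λ t' → (t ≡ + t') ×
  (γ ℤ.+ sumℤ n (λ j → if I j then + (c (τ j) ℕ.* cdiv (t' ℕ.+ J (τ j)) (p (τ j))) else ℤ.0ℤ) ℤ.≤ t)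

IsR : (n : ℕ) → (Fin n → Tau) → (Fin n → Bool) → ℤ → ℤ → Set
IsR n τ I γ r = IsLeast (FeasR n τ I γ) r

{-# OPTIONS --safe #-}
-- Reading t = β − s, the constraint s + p_i x_i ≥ β + J_i says exactly x_i ≥ ⌈(t + J_i)/p_i⌉,
-- so an optimal x is the vector of these ceilings and M(I,β) ≤ k becomes
-- s + Σ_{i∈I} c_i ⌈(t + J_i)/p_i⌉ ≤ k, i.e. t is feasible for R(I, β − k).
-- Only p_i ≥ 1 and the existence of an optimal solution with s ≤ β (so that t ≥ 0) are needed.
module Submission where

open import Defs
open import Data.Nat as ℕ using (ℕ; zero; suc)
open import Data.Nat.DivMod using (_/_; _%_; m≡m%n+[m/n]*n; m%n<n; m<n*o⇒m/o<n)
open import Data.Integer as ℤ using (ℤ; +_; -[1+_]; +≤+)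
open import Data.Integer.Tactic.RingSolver using (solve-∀)
import Data.Rational as ℚ
open import Data.Fin using (Fin)
import Data.Fin as Fin
open import Data.Bool using (Bool; true; false; if_then_else_)
open import Data.Product using (_,_; proj₁; proj₂)
open import Function.Bundles using (_⇔_; mk⇔; Equivalence)
open import Relation.Binary.PropositionalEquality using (_≡_; refl; sym; cong; cong₂)
import Data.Nat.Properties as ℕₚ
import Data.Integer.Properties as ℤₚ

sumℤ-cong : ∀ n {f g : Fin n → ℤ} → (∀ j → f j ≡ g j) → sumℤ n f ≡ sumℤ n g
sumℤ-cong zero    f≡g = refl
sumℤ-cong (suc n) f≡g = cong₂ ℤ._+_ (f≡g Fin.zero) (sumℤ-cong n (λ j → f≡g (Fin.suc j)))

sumℤ-mono-≤ : ∀ n {f g : Fin n → ℤ} → (∀ j → f j ℤ.≤ g j) → sumℤ n f ℤ.≤ sumℤ n g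
sumℤ-mono-≤ zero    f≤g = ℤₚ.≤-refl
sumℤ-mono-≤ (suc n) f≤g = ℤₚ.+-mono-≤ (f≤g Fin.zero) (sumℤ-mono-≤ n (λ j → f≤g (Fin.suc j)))

if-mono-≤ : ∀ (b : Bool) {u v : ℤ} → (b ≡ true → u ℤ.≤ v) →
            (if b then u else ℤ.0ℤ) ℤ.≤ (if b then v else ℤ.0ℤ)
if-mono-≤ true  u≤v = u≤v refl
if-mono-≤ false _   = ℤₚ.≤-refl

+-cancelˡ-≤ : ∀ i {j k} → i ℤ.+ j ℤ.≤ i ℤ.+ k → j ℤ.≤ k
+-cancelˡ-≤ i {j} {k} i+j≤i+k = begin
  j                       ≡⟨ undo i j ⟩
  ℤ.- i ℤ.+ (i ℤ.+ j)     ≤⟨ ℤₚ.+-monoʳ-≤ (ℤ.- i) i+j≤i+k ⟩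
  ℤ.- i ℤ.+ (i ℤ.+ k)     ≡⟨ sym (undo i k) ⟩
  k                       ∎
  where
  open ℤₚ.≤-Reasoning
  undo : ∀ i l → l ≡ ℤ.- i ℤ.+ (i ℤ.+ l)
  undo = solve-∀

slack-shift : ∀ s t k P → (s ℤ.+ t ℤ.- k) ℤ.+ P ℤ.≤ t ⇔ s ℤ.+ P ℤ.≤ k
slack-shift s t k P = mk⇔ to from
  where
  open ℤₚ.≤-Reasoning
  to : (s ℤ.+ t ℤ.- k) ℤ.+ P ℤ.≤ t → s ℤ.+ P ℤ.≤ k
  to h = begin
    s ℤ.+ P                                 ≡⟨ regroup₁ s t k P ⟩
    ((s ℤ.+ t ℤ.- k) ℤ.+ P) ℤ.+ (k ℤ.- t)   ≤⟨ ℤₚ.+-monoˡ-≤ (k ℤ.- t) h ⟩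
    t ℤ.+ (k ℤ.- t)                         ≡⟨ cancel t k ⟩
    k                                       ∎
    where
    regroup₁ : ∀ s t k P → s ℤ.+ P ≡ ((s ℤ.+ t ℤ.- k) ℤ.+ P) ℤ.+ (k ℤ.- t)
    regroup₁ = solve-∀
    cancel : ∀ t k → t ℤ.+ (k ℤ.- t) ≡ k
    cancel = solve-∀
  from : s ℤ.+ P ℤ.≤ k → (s ℤ.+ t ℤ.- k) ℤ.+ P ℤ.≤ t
  from h = begin
    (s ℤ.+ t ℤ.- k) ℤ.+ P   ≡⟨ regroup₂ s t k P ⟩
    (s ℤ.+ P) ℤ.+ (t ℤ.- k) ≤⟨ ℤₚ.+-monoˡ-≤ (t ℤ.- k) h ⟩
    k ℤ.+ (t ℤ.- k)         ≡⟨ cancel k t ⟩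
    t                       ∎
    where
    regroup₂ : ∀ s t k P → (s ℤ.+ t ℤ.- k) ℤ.+ P ≡ (s ℤ.+ P) ℤ.+ (t ℤ.- k)
    regroup₂ = solve-∀
    cancel : ∀ k t → k ℤ.+ (t ℤ.- k) ≡ t
    cancel = solve-∀

cdiv-cover : ∀ a p → 1 ℕ.≤ p → a ℕ.≤ p ℕ.* cdiv a p
cdiv-cover a (suc q) _ = ℕₚ.+-cancelʳ-≤ q a (suc q ℕ.* quot) (begin
  a ℕ.+ q                ≡⟨ m≡m%n+[m/n]*n (a ℕ.+ q) (suc q) ⟩
  rem ℕ.+ quot ℕ.* suc q ≤⟨ ℕₚ.+-monoˡ-≤ (quot ℕ.* suc q) (ℕ.s≤s⁻¹ (m%n<n (a ℕ.+ q) (suc q))) ⟩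
  q ℕ.+ quot ℕ.* suc q   ≡⟨ ℕₚ.+-comm q _ ⟩
  quot ℕ.* suc q ℕ.+ q   ≡⟨ cong (ℕ._+ q) (ℕₚ.*-comm quot (suc q)) ⟩
  suc q ℕ.* quot ℕ.+ q   ∎)
  where
  open ℕₚ.≤-Reasoning
  quot rem : ℕ
  quot = (a ℕ.+ q) / suc q
  rem  = (a ℕ.+ q) % suc q

cdiv-least : ∀ a p y → 1 ℕ.≤ p → a ℕ.≤ p ℕ.* y → cdiv a p ℕ.≤ y
cdiv-least a (suc q) y _ a≤py = ℕ.s≤s⁻¹ (m<n*o⇒m/o<n {a ℕ.+ q} {suc y} {suc q} (begin-strict
  a ℕ.+ q                ≤⟨ ℕₚ.+-monoˡ-≤ q a≤py ⟩
  suc q ℕ.* y ℕ.+ q      <⟨ ℕₚ.+-monoʳ-< (suc q ℕ.* y) (ℕₚ.n<1+n q) ⟩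
  suc q ℕ.* y ℕ.+ suc q  ≡⟨ cong (ℕ._+ suc q) (ℕₚ.*-comm (suc q) y) ⟩
  y ℕ.* suc q ℕ.+ suc q  ≡⟨ ℕₚ.+-comm (y ℕ.* suc q) (suc q) ⟩
  suc y ℕ.* suc q        ∎))
  where open ℕₚ.≤-Reasoning

cdiv-leastℤ : ∀ a p (x : ℤ) → 1 ℕ.≤ p → + a ℤ.≤ + p ℤ.* x → + cdiv a p ℤ.≤ x
cdiv-leastℤ a p (+ y) p≥1 a≤py =
  +≤+ (cdiv-least a p y p≥1 (ℤₚ.drop‿+≤+ (ℤₚ.≤-trans a≤py (ℤₚ.≤-reflexive (sym (ℤₚ.pos-* p y))))))
cdiv-leastℤ _ (suc _) -[1+ _ ] _ ()

module _ (n : ℕ) (τ : Fin n → Tau) (I : Fin n → Bool) where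

  cost : (Fin n → ℤ) → ℤ
  cost x = sumℤ n (λ j → if I j then + c (τ j) ℤ.* x j else ℤ.0ℤ)

  demand : ℕ → ℤ
  demand t = sumℤ n (λ j → if I j then + (c (τ j) ℕ.* cdiv (t ℕ.+ J (τ j)) (p (τ j))) else ℤ.0ℤ)

  ceilSol : ℕ → Fin n → ℤ
  ceilSol t j = + cdiv (t ℕ.+ J (τ j)) (p (τ j))

  cost-ceilSol : ∀ t → cost (ceilSol t) ≡ demand t
  cost-ceilSol t = sumℤ-cong n (λ j →
    cong (λ v → if I j then v else ℤ.0ℤ) (sym (ℤₚ.pos-* (c (τ j)) (cdiv (t ℕ.+ J (τ j)) (p (τ j))))))

  module _ (p-pos : ∀ j → 1 ℕ.≤ p (τ j)) where

    ceilSol-feasible : ∀ {s t b} → s ℕ.+ t ≡ b → FeasM n τ I (+ b) s (ceilSol t)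
    ceilSol-feasible {s} {t} refl j _ = begin
      + (s ℕ.+ t ℕ.+ J (τ j))                 ≡⟨ cong +_ (ℕₚ.+-assoc s t (J (τ j))) ⟩
      + s ℤ.+ + (t ℕ.+ J (τ j))               ≤⟨ ℤₚ.+-monoʳ-≤ (+ s) (+≤+ (cdiv-cover _ _ (p-pos j))) ⟩
      + s ℤ.+ + (p (τ j) ℕ.* cdiv (t ℕ.+ J (τ j)) (p (τ j)))
                                              ≡⟨ cong (ℤ._+_ (+ s)) (ℤₚ.pos-* (p (τ j)) _) ⟩
      + s ℤ.+ + p (τ j) ℤ.* ceilSol t j       ∎
      where open ℤₚ.≤-Reasoning

    demand≤cost : ∀ {s t b x} → s ℕ.+ t ≡ b → FeasM n τ I (+ b) s x → demand t ℤ.≤ cost x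
    demand≤cost {s} {t} {x = x} refl feasible = sumℤ-mono-≤ n (λ j → if-mono-≤ (I j) (λ j∈I → begin
      + (c (τ j) ℕ.* cdiv (t ℕ.+ J (τ j)) (p (τ j)))  ≡⟨ ℤₚ.pos-* (c (τ j)) _ ⟩
      + c (τ j) ℤ.* ceilSol t j                         ≤⟨ ℤₚ.*-monoˡ-≤-nonNeg (+ c (τ j)) (ceilSol≤ j j∈I) ⟩
      + c (τ j) ℤ.* x j                                 ∎))
      where
      open ℤₚ.≤-Reasoning
      ceilSol≤ : ∀ j → I j ≡ true → ceilSol t j ℤ.≤ x j
      ceilSol≤ j j∈I = cdiv-leastℤ _ _ (x j) (p-pos j) (+-cancelˡ-≤ (+ s) (begin
        + s ℤ.+ + (t ℕ.+ J (τ j))   ≡⟨ cong +_ (sym (ℕₚ.+-assoc s t (J (τ j)))) ⟩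
        + (s ℕ.+ t ℕ.+ J (τ j))     ≤⟨ feasible j j∈I ⟩
        + s ℤ.+ + p (τ j) ℤ.* x j   ∎))

    R-feasible⇒M≤ : ∀ {s t b k m} → s ℕ.+ t ≡ b → IsM n τ I (+ b) m →
                    FeasR n τ I (+ b ℤ.- k) (+ t) → m ℤ.≤ k
    R-feasible⇒M≤ {s} {t} {k = k} {m} refl (_ , m-least) (_ , refl , slack) = begin
      m                         ≤⟨ m-least _ (s , ceilSol t , ceilSol-feasible refl , refl) ⟩
      + s ℤ.+ cost (ceilSol t)  ≡⟨ cong (ℤ._+_ (+ s)) (cost-ceilSol t) ⟩
      + s ℤ.+ demand t          ≤⟨ Equivalence.to (slack-shift (+ s) (+ t) k (demand t)) slack ⟩
      k                         ∎
      where open ℤₚ.≤-Reasoning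

    optimal⇒R-feasible : ∀ {s t b x k m} → s ℕ.+ t ≡ b → OptM n τ I (+ b) s x →
                         IsM n τ I (+ b) m → m ℤ.≤ k → FeasR n τ I (+ b ℤ.- k) (+ t)
    optimal⇒R-feasible {s} {t} {x = x} {k} refl (feasible , optimal) ((s′ , x′ , feasible′ , refl) , _) m≤k =
      t , refl , Equivalence.from (slack-shift (+ s) (+ t) k (demand t)) (begin
        + s ℤ.+ demand t   ≤⟨ ℤₚ.+-monoʳ-≤ (+ s) (demand≤cost refl feasible) ⟩
        + s ℤ.+ cost x     ≤⟨ optimal s′ x′ feasible′ ⟩
        objM n τ I s′ x′   ≤⟨ m≤k ⟩
        k                  ∎)
      where open ℤₚ.≤-Reasoning

corollary22 : (n : ℕ) → 2 ℕ.≤ n → (τ : Fin n → Tau) → ((j : Fin n) → ValidTau (τ j)) →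
    frontSum n τ ℚ.< ℚ.1ℚ →
    (I : Fin n → Bool) → SubsetFront n I →
    (β : ℤ) (S : ℤ) → IsGreatest (OptS n τ I β) S → S ℤ.≤ β →
    (k : ℤ) (m : ℤ) → IsM n τ I β m → (r : ℤ) → IsR n τ I (β ℤ.- k) r →
    (m ℤ.≤ k) ⇔ (r ℤ.≤ β)
corollary22 _ _ _ _ _ _ _ -[1+ _ ] _ ((_ , _ , _ , refl) , _) () _ _ _ _ _
corollary22 n _ τ valid _ I _ (+ b) _ ((s , _ , optimal , refl) , _) (+≤+ s≤b) k m isM r
            (feasR@(_ , refl , _) , r-least) = mk⇔ M≤⇒R≤ R≤⇒M≤
  where
  p-pos : ∀ j → 1 ℕ.≤ p (τ j)
  p-pos j = proj₁ (proj₂ (valid j))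

  M≤⇒R≤ : m ℤ.≤ k → r ℤ.≤ + b
  M≤⇒R≤ m≤k = ℤₚ.≤-trans
    (r-least _ (optimal⇒R-feasible n τ I p-pos (ℕₚ.m+[n∸m]≡n s≤b) optimal isM m≤k))
    (+≤+ (ℕₚ.m∸n≤m b s))

  R≤⇒M≤ : r ℤ.≤ + b → m ℤ.≤ k
  R≤⇒M≤ (+≤+ t≤b) = R-feasible⇒M≤ n τ I p-pos (ℕₚ.m∸n+n≡m t≤b) isM feasR
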